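{- There exists a function $f:\mathbb N\to\mathbb N$ such that the following holds. Let $G$ be a graph, $F=(\iota,\tau)$ a $k$-flip on $V(G)$, and $I$ an independent set of $G\oplus F$. Then there exist a partition $I_1,\dots,I_p$ of $I$ into at most $2k$ parts and an $f(k)$-flip $F'$ on $V(G)$ such that $G\ast I_1\ast\dots\ast I_p\oplus F'=G\oplus F\ast I$ (in particular each $I_j$ is independent in the graph to which it is applied).
   Context: Graphs are finite and simple; adjacency $E_G(u,v)\in\mathrm{GF}(2)$. A $k$-flip on $V$ is $F=(\iota,\tau)$ with $\iota:V\to[k]$ and $\tau:[k]\times[k]\to\mathrm{GF}(2)$ symmetric; $G\oplus F$ has $E_{G\oplus F}(x,y)=E_G(x,y)+\tau(\iota(x),\iota(y))$ for distinct $x,y$. For a vertex $v$, $E_{G\ast v}(x,y)=E_G(x,y)+E_G(x,v)E_G(v,y)$; for a set $J$ independent in the current graph, $\ast J$ denotes successive local complementation of all vertices of $J$; the notation $H\ast J$ is only used when $J$ is independent in $H$. Expressions are evaluated left to right. -}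

module Defs where

open import Data.Bool using (Bool; true; false; _xor_; _∧_; if_then_else_)
open import Data.Fin using (Fin; _≟_)
open import Data.Nat using (ℕ)
open import Data.List using (List; []; _∷_; foldl; allFin; length)
open import Data.List.Relation.Unary.All using (All)
open import Data.List.Relation.Unary.Any using (Any)
open import Data.List.Relation.Unary.AllPairs using (AllPairs)
open import Data.Product using (_×_; ∃)
open import Data.Unit using (⊤)
open import Relation.Nullary using (does; ¬_)
open import Relation.Binary.PropositionalEquality using (_≡_)

-- Graphs on the vertex set Fin n, adjacency valued in GF(2) = Bool (with xor as +).
Graph : ℕ → Set
Graph n = Fin n → Fin n → Bool

record IsSimple {n : ℕ} (G : Graph n) : Set where
  field
    sym    : ∀ x y → G x y ≡ G y x
    irrefl : ∀ x → G x x ≡ false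

VSet : ℕ → Set
VSet n = Fin n → Bool

record Flip (n k : ℕ) : Set where
  field
    ι     : Fin n → Fin k
    τ     : Fin k → Fin k → Bool
    τ-sym : ∀ a b → τ a b ≡ τ b a
open Flip public

_⊕_ : ∀ {n k} → Graph n → Flip n k → Graph n
(G ⊕ F) x y = if does (x ≟ y) then false else (G x y xor τ F (ι F x) (ι F y))

_⋆_ : ∀ {n} → Graph n → Fin n → Graph n
(G ⋆ v) x y = if does (x ≟ y) then false else (G x y xor (G x v ∧ G v y))

Independent : ∀ {n} → Graph n → VSet n → Set
Independent G J = ∀ x y → J x ≡ true → J y ≡ true → G x y ≡ false

-- G ∗ J : successive local complementation at all vertices of J
-- (in increasing vertex order; for independent J the order is irrelevant).
_⋆ₛ_ : ∀ {n} → Graph n → VSet n → Graph n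
_⋆ₛ_ {n} G J = foldl (λ H v → if J v then H ⋆ v else H) G (allFin n)

⋆Seq : ∀ {n} → Graph n → List (VSet n) → Graph n
⋆Seq G Js = foldl _⋆ₛ_ G Js

ValidSeq : ∀ {n} → Graph n → List (VSet n) → Set
ValidSeq G []       = ⊤
ValidSeq G (J ∷ Js) = Independent G J × ValidSeq (G ⋆ₛ J) Js

_≐_ : ∀ {n} → Graph n → Graph n → Set
G ≐ H = ∀ x y → G x y ≡ H x y

IsPartition : ∀ {n} → List (VSet n) → VSet n → Set
IsPartition {n} Js I =
    All (λ J → ∃ λ (v : Fin n) → J v ≡ true) Js
  × All (λ J → ∀ v → J v ≡ true → I v ≡ true) Js
  × (∀ v → I v ≡ true → Any (λ J → J v ≡ true) Js)
  × AllPairs (λ J J′ → ∀ v → ¬ (J v ≡ true × J′ v ≡ true)) Js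

-- Write H = G ⊕ F. Complementing H at an independent set J lying in one colour class
-- of F can be replayed on G: for x, y ∉ J the parity Σ_{v ∈ J} H x v H v y is the corresponding
-- parity in G plus terms that depend only on the colours of x and y, on the parities of their
-- G-neighbourhoods in J and on |J| mod 2, so (G ∗ J) ⊕ F′ = H ∗ J for a flip F′ with four times as
-- many colours. Since I is independent in H, H ∗ I is obtained by complementing its colour classes
-- one after the other, and throughout, the unprocessed vertices of a class of I stay inside one
-- colour class of the current flip. In the current G such a class is a clique or an independent
-- set; complementing first at a single vertex of it makes the remainder independent. This gives
-- two parts per colour and 16 ^ k * k colours in the end.

module Submission where

open import Defs
open import Data.Nat using (ℕ; _≤_; _*_)
open import Data.List using (List; length)
open import Data.Product using (Σ; ∃; _×_)

open import Level using (0ℓ)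
open import Algebra.Bundles using (CommutativeRing)
open import Data.Bool using (Bool; true; false; _xor_; _∧_; _∨_; not; if_then_else_)
open import Data.Bool.Properties
  using ( xor-∧-commutativeRing; xor-identityʳ; xor-assoc; xor-same; ∧-idem; ∧-comm
        ; ∧-zeroʳ; ∧-conicalˡ; ∧-conicalʳ; ∨-conicalˡ; ∨-conicalʳ; ∨-zeroʳ; ∨-comm; ¬-not )
  renaming (_≟_ to _≟ᵇ_)
open import Data.Empty using (⊥-elim)
open import Data.Fin using (Fin; zero; suc; _≟_)
open import Data.Nat using (zero; suc; _+_)
open import Data.Fin.Properties using (any?; *↔×; 2↔Bool)
open import Data.Maybe using (just; nothing)
open import Data.Nat.Properties using (*-suc; ≤-reflexive; ≤-trans)
open import Data.List using ([]; _∷_; foldl; foldr; allFin; tabulate; filter)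
open import Data.List.Properties using (length-filter; length-tabulate)
open import Data.List.Membership.Propositional using (_∈_)
open import Data.List.Membership.Propositional.Properties using (∈-allFin)
open import Data.List.Relation.Unary.All as All using (All; []; _∷_)
import Data.List.Relation.Unary.All.Properties as All
open import Data.List.Relation.Unary.Any using (Any; here; there)
import Data.List.Relation.Unary.Any.Properties as Any
open import Data.List.Relation.Unary.AllPairs using (AllPairs; []; _∷_)
import Data.List.Relation.Unary.AllPairs.Properties as AllPairs
open import Data.List.Relation.Unary.Unique.Propositional using (Unique)
open import Data.List.Relation.Unary.Unique.Propositional.Properties using (allFin⁺)
open import Data.Product using (_,_; proj₁; proj₂)
open import Data.Product.Function.NonDependent.Propositional using (_×-↔_)
open import Data.Sum using (_⊎_; inj₁; inj₂)
open import Data.Unit using (tt)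
open import Function using (_∘_; _↔_; Inverse)
open import Function.Properties.Inverse using (↔-refl; ↔-trans)
open import Relation.Nullary using (¬_; Dec; yes; no; does)
open import Relation.Unary using (Decidable)
open import Relation.Binary.PropositionalEquality
open import Tactic.RingSolver using (solve-∀)
open import Tactic.RingSolver.Core.AlmostCommutativeRing
  using (AlmostCommutativeRing; fromCommutativeRing)

GF₂ : AlmostCommutativeRing 0ℓ 0ℓ
GF₂ = fromCommutativeRing xor-∧-commutativeRing λ { false → just refl ; true → nothing }

open import Algebra.Properties.Semiring.Sum (CommutativeRing.semiring xor-∧-commutativeRing)
  using (sum; sum-cong-≗; ∑-distrib-+; *-distribˡ-sum; *-distribʳ-sum; sum-replicate-zero)

xor-interchange : ∀ w x y z → (w xor x) xor (y xor z) ≡ (w xor y) xor (x xor z)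
xor-interchange = solve-∀ GF₂

xor≡false⇒≡ : ∀ {a b} → a xor b ≡ false → a ≡ b
xor≡false⇒≡ {false} {false} _ = refl
xor≡false⇒≡ {true}  {true}  _ = refl

sum-foldr-tabulate : ∀ {m n} (g : Fin m → Fin n) (f : Fin n → Bool) →
                     foldr (λ v s → f v xor s) false (tabulate g) ≡ sum (f ∘ g)
sum-foldr-tabulate {zero}  g f = refl
sum-foldr-tabulate {suc n} g f = cong (f (g zero) xor_) (sum-foldr-tabulate (g ∘ suc) f)

sum-combination : ∀ {n} (f g h k : Fin n → Bool) X Y Z →
                  sum (λ v → f v xor X ∧ g v xor Y ∧ h v xor Z ∧ k v)
                  ≡ sum f xor X ∧ sum g xor Y ∧ sum h xor Z ∧ sum k
sum-combination f g h k X Y Z =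
  trans (∑-distrib-+ f (λ v → X ∧ g v xor Y ∧ h v xor Z ∧ k v)) (cong (sum f xor_)
  (trans (∑-distrib-+ (λ v → X ∧ g v) (λ v → Y ∧ h v xor Z ∧ k v))
         (cong₂ _xor_ (sym (*-distribˡ-sum X g))
  (trans (∑-distrib-+ (λ v → Y ∧ h v) (λ v → Z ∧ k v))
         (cong₂ _xor_ (sym (*-distribˡ-sum Y h)) (sym (*-distribˡ-sum Z k)))))))

module _ {n : ℕ} where

  ∅ : VSet n
  ∅ _ = false

  ｛_｝ : Fin n → VSet n
  ｛ v ｝ u = does (u ≟ v)

  _∪_ _∖_ : VSet n → VSet n → VSet n
  (S ∪ T) u = S u ∨ T u
  (S ∖ T) u = S u ∧ not (T u)

  _⊆_ : VSet n → VSet n → Set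
  S ⊆ T = ∀ v → S v ≡ true → T v ≡ true

  Disjoint : VSet n → VSet n → Set
  Disjoint S T = ∀ v → ¬ (S v ≡ true × T v ≡ true)

  NonEmpty : VSet n → Set
  NonEmpty S = ∃ λ v → S v ≡ true

  nonEmpty? : Decidable NonEmpty
  nonEmpty? S = any? λ v → S v ≟ᵇ true

  ｛｝-sound : ∀ {u v} → ｛ v ｝ u ≡ true → u ≡ v
  ｛｝-sound {u} {v} h with u ≟ v
  ... | yes u≡v = u≡v

  ｛｝-self : ∀ v → ｛ v ｝ v ≡ true
  ｛｝-self v = cong does (≡-≟-identity _≟_ {v} refl)

  ｛｝-≢ : ∀ {u v} → u ≢ v → ｛ v ｝ u ≡ false
  ｛｝-≢ {u} {v} u≢v = cong does (≢-≟-identity _≟_ {u} {v} u≢v)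

  ∉｛｝ : ∀ {S u v} → (S ∖ ｛ v ｝) u ≡ true → u ≢ v
  ∉｛｝ {S} {u} h refl
    with () ← trans (sym (trans (cong (λ b → S u ∧ not b) (｛｝-self u)) (∧-zeroʳ (S u)))) h

  ∉-≢ : ∀ {S : VSet n} {u v} → S u ≡ false → S v ≡ true → u ≢ v
  ∉-≢ Su Sv refl with () ← trans (sym Su) Sv

  ∪-⊆ : ∀ {S T U} → S ⊆ U → T ⊆ U → (S ∪ T) ⊆ U
  ∪-⊆ {S} S⊆U T⊆U v h with S v in Sv
  ... | true  = S⊆U v Sv
  ... | false = T⊆U v h

  ⊆-trans : ∀ {S T U} → S ⊆ T → T ⊆ U → S ⊆ U
  ⊆-trans S⊆T T⊆U v = T⊆U v ∘ S⊆T v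

  ⊆-∪ˡ : ∀ {S T} → S ⊆ (S ∪ T)
  ⊆-∪ˡ {T = T} v Sv = cong (_∨ T v) Sv

  ⊆-∪ʳ : ∀ {S T} → T ⊆ (S ∪ T)
  ⊆-∪ʳ {S} v Tv = trans (cong (S v ∨_) Tv) (∨-zeroʳ (S v))

  ∖-⊆ : ∀ {S T} → (S ∖ T) ⊆ S
  ∖-⊆ {S} v = ∧-conicalˡ (S v) _

  ∖-split : ∀ {S T v} → S v ≡ true → T v ≡ true ⊎ (S ∖ T) v ≡ true
  ∖-split {T = T} {v} Sv with T v
  ... | true  = inj₁ refl
  ... | false = inj₂ (cong (_∧ true) Sv)

  ⊆-false : ∀ {S T v} → S ⊆ T → T v ≡ false → S v ≡ false
  ⊆-false {S} {v = v} S⊆T Tv with S v in Sv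
  ... | false = refl
  ... | true  = trans (sym (S⊆T v Sv)) Tv

  ⊆-antisym : ∀ {S T} → S ⊆ T → T ⊆ S → ∀ v → S v ≡ T v
  ⊆-antisym {S} {T} S⊆T T⊆S v with S v in Sv | T v in Tv
  ... | false | false = refl
  ... | true  | true  = refl
  ... | true  | false = trans (sym (S⊆T v Sv)) Tv
  ... | false | true  = sym (trans (sym (T⊆S v Tv)) Sv)

  Disjoint-∪ : ∀ {S T U} → Disjoint S U → Disjoint T U → Disjoint (S ∪ T) U
  Disjoint-∪ {S} S∩U T∩U v (S∪Tv , Uv) with S v in Sv
  ... | true  = S∩U v (Sv , Uv)
  ... | false = T∩U v (S∪Tv , Uv)

  Disjoint-⊆ : ∀ {S T U} → Disjoint S T → U ⊆ T → Disjoint S U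
  Disjoint-⊆ S∩T U⊆T v (Sv , Uv) = S∩T v (Sv , U⊆T v Uv)

  Disjoint-∖ : ∀ {S T} → Disjoint T (S ∖ T)
  Disjoint-∖ {S} v (Tv , h)
    with () ← trans (sym (trans (cong (λ b → S v ∧ not b) Tv) (∧-zeroʳ (S v)))) h

  Disjoint-intro : ∀ {S T} → (∀ v → T v ≡ true → S v ≡ false) → Disjoint S T
  Disjoint-intro T⇒¬S v (Sv , Tv) with () ← trans (sym (T⇒¬S v Tv)) Sv

  Disjoint⇒false : ∀ {S T v} → Disjoint S T → T v ≡ true → S v ≡ false
  Disjoint⇒false S∩T Tv = ¬-not λ Sv → S∩T _ (Sv , Tv)

  pick : (S : VSet n) → Dec (NonEmpty S) → VSet n
  pick S (yes (v , _)) = ｛ v ｝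
  pick S (no _)        = ∅

  pick-⊆ : ∀ {S} d → pick S d ⊆ S
  pick-⊆ {S} (yes (v , Sv)) u u≡v = subst (λ w → S w ≡ true) (sym (｛｝-sound u≡v)) Sv

sum-｛｝ : ∀ {n} v (f : Fin n → Bool) → sum (λ u → ｛ v ｝ u ∧ f u) ≡ f v
sum-｛｝ {suc n} zero    f = trans (cong (f zero xor_) (sum-replicate-zero n)) (xor-identityʳ _)
sum-｛｝ {suc n} (suc v) f = sum-｛｝ v (f ∘ suc)

Loopless : ∀ {n} → Graph n → Set
Loopless K = ∀ x → K x x ≡ false

offDiag : ∀ {n} → Fin n → Fin n → Bool → Bool
offDiag x y b = if does (x ≟ y) then false else b

offDiag-≢ : ∀ {n} {x y : Fin n} {b} → x ≢ y → offDiag x y b ≡ b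
offDiag-≢ {x = x} {y} x≢y with x ≟ y
... | yes x≡y = ⊥-elim (x≢y x≡y)
... | no  _   = refl

offDiag-cong : ∀ {n} (x y : Fin n) {b c} → (x ≢ y → b ≡ c) → offDiag x y b ≡ offDiag x y c
offDiag-cong x y b≡c with x ≟ y
... | yes _   = refl
... | no  x≢y = b≡c x≢y

offDiag-swap : ∀ {n} (x y : Fin n) {b c} → (x ≢ y → b ≡ c) → offDiag x y b ≡ offDiag y x c
offDiag-swap x y b≡c with x ≟ y | y ≟ x
... | yes _   | yes _   = refl
... | no  x≢y | no  _   = b≡c x≢y
... | yes x≡y | no  y≢x = ⊥-elim (y≢x (sym x≡y))
... | no  x≢y | yes y≡x = ⊥-elim (x≢y (sym y≡x))

offDiag-diag : ∀ {n} (x : Fin n) {b} → offDiag x x b ≡ false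
offDiag-diag x with x ≟ x
... | yes _   = refl
... | no  x≢x = ⊥-elim (x≢x refl)

offDiag-xor-false : ∀ {n} {K : Graph n} → Loopless K → ∀ x y {c} → c ≡ false →
                    offDiag x y (K x y xor c) ≡ K x y
offDiag-xor-false {K = K} K-loopless x y refl with x ≟ y
... | yes refl = sym (K-loopless x)
... | no  _    = xor-identityʳ (K x y)

IsSimple-resp-≐ : ∀ {n} {K K′ : Graph n} → K ≐ K′ → IsSimple K → IsSimple K′
IsSimple-resp-≐ {K = K} {K′} K≐K′ K-simple = record
  { sym    = λ x y → trans (sym (K≐K′ x y)) (trans (IsSimple.sym K-simple x y) (K≐K′ y x))
  ; irrefl = λ x → trans (sym (K≐K′ x x)) (IsSimple.irrefl K-simple x) }

Independent-resp-≐ : ∀ {n} {K K′ : Graph n} {J} → K ≐ K′ → Independent K J → Independent K′ J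
Independent-resp-≐ K≐K′ J-indep u w Ju Jw = trans (sym (K≐K′ u w)) (J-indep u w Ju Jw)

⊕-cong : ∀ {n m} {K K′ : Graph n} (F : Flip n m) → K ≐ K′ → (K ⊕ F) ≐ (K′ ⊕ F)
⊕-cong F K≐K′ x y = cong (λ e → offDiag x y (e xor τ F (ι F x) (ι F y))) (K≐K′ x y)

⊕-non-adjacent : ∀ {n m} {G : Graph n} {F : Flip n m} {u w} → u ≢ w →
                 (G ⊕ F) u w ≡ false → G u w ≡ τ F (ι F u) (ι F w)
⊕-non-adjacent u≢w not-adjacent = xor≡false⇒≡ (trans (sym (offDiag-≢ u≢w)) not-adjacent)

module _ {k} {C : Set} (code : Fin k ↔ C) where
  open Inverse code using (to; from; strictlyInverseˡ)

  flipVia : ∀ {n} → (Fin n → C) → (t : C → C → Bool) → (∀ c d → t c d ≡ t d c) → Flip n k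
  flipVia colour t t-sym = record
    { ι     = from ∘ colour
    ; τ     = λ i j → t (to i) (to j)
    ; τ-sym = λ i j → t-sym (to i) (to j) }

  ⊕-flipVia : ∀ {n} {G : Graph n} colour t t-sym x y →
              (G ⊕ flipVia colour t t-sym) x y ≡ offDiag x y (G x y xor t (colour x) (colour y))
  ⊕-flipVia {G = G} colour t _ x y =
    cong₂ (λ c d → offDiag x y (G x y xor t c d))
          (strictlyInverseˡ (colour x)) (strictlyInverseˡ (colour y))

-- Simultaneous local complementation

-- The closed form of K ∗ J, which is only valid when J is independent in K (⋆ₛ≐LC).
module _ {n} (K : Graph n) (J : VSet n) where

  commonParity : Fin n → Fin n → Bool
  commonParity x y = sum λ v → J v ∧ (K x v ∧ K v y)

  LC : Graph n
  LC x y = offDiag x y (K x y xor commonParity x y)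

module _ {n} {K : Graph n} where

  LC-∅ : Loopless K → LC K ∅ ≐ K
  LC-∅ K-loopless x y = offDiag-xor-false K-loopless x y (sum-replicate-zero n)

  LC-cong-graph : ∀ {K′} J → K ≐ K′ → LC K J ≐ LC K′ J
  LC-cong-graph J K≐K′ x y =
    cong₂ (λ e c → offDiag x y (e xor c)) (K≐K′ x y)
          (sum-cong-≗ λ v → cong (J v ∧_) (cong₂ _∧_ (K≐K′ x v) (K≐K′ v y)))

  LC-cong-set : ∀ {J J′} → (∀ v → J v ≡ J′ v) → LC K J ≐ LC K J′
  LC-cong-set J≗J′ x y =
    cong (λ c → offDiag x y (K x y xor c)) (sum-cong-≗ λ v → cong (_∧ _) (J≗J′ v))

  LC-simple : ∀ J → IsSimple K → IsSimple (LC K J)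
  LC-simple J K-simple = record
    { sym    = λ x y → offDiag-swap x y λ _ → cong₂ _xor_ (K-sym x y) (sum-cong-≗ λ v →
                 cong (J v ∧_) (trans (∧-comm (K x v) _) (cong₂ _∧_ (K-sym v y) (K-sym x v))))
    ; irrefl = λ x → offDiag-diag x }
    where K-sym = IsSimple.sym K-simple

  module _ {I : VSet n} (I-indep : Independent K I) where

    commonParity-vanishes : ∀ {Q} → Q ⊆ I → ∀ {x y} → I x ≡ true ⊎ I y ≡ true →
                            commonParity K Q x y ≡ false
    commonParity-vanishes {Q} Q⊆I {x} {y} Ix⊎Iy =
      trans (sum-cong-≗ (path-vanishes Ix⊎Iy)) (sum-replicate-zero n)
      where
        path-vanishes : I x ≡ true ⊎ I y ≡ true → ∀ v → Q v ∧ (K x v ∧ K v y) ≡ false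
        path-vanishes Ix⊎Iy v with Q v in Qv | Ix⊎Iy
        ... | false | _       = refl
        ... | true  | inj₁ Ix rewrite I-indep x v Ix (Q⊆I v Qv) = refl
        ... | true  | inj₂ Iy rewrite I-indep v y (Q⊆I v Qv) Iy = ∧-zeroʳ (K x v)

    module _ (K-loopless : Loopless K) where

      LC-fixes : ∀ {Q} → Q ⊆ I → ∀ {x y} → I x ≡ true ⊎ I y ≡ true → LC K Q x y ≡ K x y
      LC-fixes Q⊆I {x} {y} Ix⊎Iy =
        offDiag-xor-false K-loopless x y (commonParity-vanishes Q⊆I Ix⊎Iy)

      LC-merge : ∀ {P J} → P ⊆ I → J ⊆ I → Disjoint P J → LC (LC K P) J ≐ LC K (P ∪ J)
      LC-merge {P} {J} P⊆I J⊆I P∩J x y = offDiag-cong x y λ x≢y → begin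
          LC K P x y xor commonParity (LC K P) J x y
            ≡⟨ cong₂ _xor_ (offDiag-≢ x≢y) (sum-cong-≗ same-paths) ⟩
          (K x y xor commonParity K P x y) xor commonParity K J x y
            ≡⟨ xor-assoc (K x y) _ _ ⟩
          K x y xor (commonParity K P x y xor commonParity K J x y)
            ≡⟨ cong (K x y xor_) (∑-distrib-+ (λ v → P v ∧ path v) (λ v → J v ∧ path v)) ⟨
          K x y xor sum (λ v → P v ∧ path v xor J v ∧ path v)
            ≡⟨ cong (K x y xor_) (sum-cong-≗ split) ⟨
          K x y xor commonParity K (P ∪ J) x y ∎
        where
          open ≡-Reasoning
          path : Fin n → Bool
          path v = K x v ∧ K v y

          same-paths : ∀ v → J v ∧ (LC K P x v ∧ LC K P v y) ≡ J v ∧ path v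
          same-paths v with J v in Jv
          ... | false = refl
          ... | true  = cong₂ _∧_ (LC-fixes P⊆I (inj₂ (J⊆I v Jv)))
                                  (LC-fixes P⊆I (inj₁ (J⊆I v Jv)))

          split : ∀ v → (P v ∨ J v) ∧ path v ≡ P v ∧ path v xor J v ∧ path v
          split v with P v in Pv | J v in Jv
          ... | false | _     = refl
          ... | true  | false = sym (xor-identityʳ (path v))
          ... | true  | true  = ⊥-elim (P∩J v (Pv , Jv))

module _ {n} {H : Graph n} (H-loopless : Loopless H) {J : VSet n} (J-indep : Independent H J) where

  private
    complementAt : Graph n → Fin n → Graph n
    complementAt K v = if J v then K ⋆ v else K

    pathSum : List (Fin n) → Fin n → Fin n → Bool
    pathSum L x y = foldr (λ v s → (J v ∧ (H x v ∧ H v y)) xor s) false L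

    AgreesOnJ : Graph n → Set
    AgreesOnJ K = ∀ x v → J v ≡ true → K x v ≡ H x v × K v x ≡ H v x

    offDiag-agrees : ∀ {K : Graph n} {x y c} → K x y ≡ H x y → c ≡ false →
                     offDiag x y (K x y xor c) ≡ H x y
    offDiag-agrees {x = x} {y} {c} Kxy c≡false =
      trans (cong (λ e → offDiag x y (e xor c)) Kxy) (offDiag-xor-false H-loopless x y c≡false)

    -- Complementing at v ∈ J leaves the pairs meeting J untouched, as J is independent; so each
    -- step just adds H x v ∧ H v y.
    fold-complement : ∀ L K → Loopless K → AgreesOnJ K → ∀ x y →
                      foldl complementAt K L x y ≡ offDiag x y (K x y xor pathSum L x y)
    fold-complement []      K K-loopless _      x y = sym (offDiag-xor-false K-loopless x y refl)
    fold-complement (v ∷ L) K K-loopless agrees x y with J v in Jv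
    ... | false = fold-complement L K K-loopless agrees x y
    ... | true  = begin
      foldl complementAt (K ⋆ v) L x y
        ≡⟨ fold-complement L (K ⋆ v) (λ x → offDiag-diag x) agrees-⋆ x y ⟩
      offDiag x y ((K ⋆ v) x y xor pathSum L x y)
        ≡⟨ offDiag-cong x y (λ x≢y →
             trans (cong (_xor pathSum L x y) (offDiag-≢ x≢y)) (xor-assoc (K x y) _ _)) ⟩
      offDiag x y (K x y xor ((K x v ∧ K v y) xor pathSum L x y))
        ≡⟨ cong (λ t → offDiag x y (K x y xor (t xor pathSum L x y)))
                (cong₂ _∧_ (proj₁ (agrees x v Jv)) (proj₂ (agrees y v Jv))) ⟩
      offDiag x y (K x y xor ((H x v ∧ H v y) xor pathSum L x y)) ∎
      where
        open ≡-Reasoning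
        agrees-⋆ : AgreesOnJ (K ⋆ v)
        agrees-⋆ x u Ju =
            offDiag-agrees {K} (proj₁ (agrees x u Ju))
              (trans (cong (K x v ∧_) (trans (proj₁ (agrees v u Ju)) (J-indep v u Jv Ju))) (∧-zeroʳ _))
          , offDiag-agrees {K} (proj₂ (agrees x u Ju))
              (cong (_∧ K v x) (trans (proj₁ (agrees u v Jv)) (J-indep u v Ju Jv)))

  ⋆ₛ≐LC : (H ⋆ₛ J) ≐ LC H J
  ⋆ₛ≐LC x y =
    trans (fold-complement (allFin n) H H-loopless (λ _ _ _ → refl , refl) x y)
          (cong (λ s → offDiag x y (H x y xor s))
                (sum-foldr-tabulate (λ v → v) (λ v → J v ∧ (H x v ∧ H v y))))

⋆ₛ-∅ : ∀ {n} {G : Graph n} {J} → ¬ NonEmpty J → G ⋆ₛ J ≡ G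
⋆ₛ-∅ {n} {G} {J} J-empty = skip (allFin n)
  where
    skip : ∀ L → foldl (λ K v → if J v then K ⋆ v else K) G L ≡ G
    skip []      = refl
    skip (v ∷ L) rewrite ¬-not (λ Jv → J-empty (v , Jv)) = skip L

module _ {n : ℕ} where

  ⋆Seq-filter : ∀ (G : Graph n) Js → ⋆Seq G (filter nonEmpty? Js) ≡ ⋆Seq G Js
  ⋆Seq-filter G []       = refl
  ⋆Seq-filter G (J ∷ Js) with nonEmpty? J
  ... | yes _       = ⋆Seq-filter (G ⋆ₛ J) Js
  ... | no  J-empty = trans (⋆Seq-filter G Js) (cong (λ K → ⋆Seq K Js) (sym (⋆ₛ-∅ J-empty)))

  ValidSeq-filter : ∀ {G : Graph n} Js → ValidSeq G Js → ValidSeq G (filter nonEmpty? Js)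
  ValidSeq-filter []       tt                = tt
  ValidSeq-filter (J ∷ Js) (J-indep , valid) with nonEmpty? J
  ... | yes _       = J-indep , ValidSeq-filter Js valid
  ... | no  J-empty = ValidSeq-filter Js (subst (λ K → ValidSeq K Js) (⋆ₛ-∅ J-empty) valid)

  IsPartition-filter : ∀ {I : VSet n} {Js} → All (_⊆ I) Js →
                       (∀ v → I v ≡ true → Any (λ J → J v ≡ true) Js) → AllPairs Disjoint Js →
                       IsPartition (filter nonEmpty? Js) I
  IsPartition-filter {I} {Js} parts⊆I covers disjoint =
      All.all-filter nonEmpty? Js
    , All.filter⁺ nonEmpty? parts⊆I
    , covers-filter
    , AllPairs.filter⁺ nonEmpty? disjoint
    where
      covers-filter : ∀ v → I v ≡ true → Any (λ J → J v ≡ true) (filter nonEmpty? Js)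
      covers-filter v Iv with Any.filter⁺ nonEmpty? (covers v Iv)
      ... | inj₁ found = found
      ... | inj₂ empty = ⊥-elim (empty (v , Any.lookup-result (covers v Iv)))

-- Refining a flip along a local complementation

module Refinement {n m} (G : Graph n) (F : Flip n m) (J : VSet n) (b : Fin m) where

  Colour : Set
  Colour = Fin m × Bool × Bool

  neighbourParity : Fin n → Bool
  neighbourParity x = sum λ v → J v ∧ G x v

  colour : Fin n → Colour
  colour x = ι F x , neighbourParity x , J x

  -- For x, y ∉ J, expanding Σ_{v ∈ J} (G x v + τ (ι x) b) (G v y + τ b (ι y)) produces the
  -- G-term plus `correction`; next to J both sums vanish, so the last coordinate switches it off.
  correction : Fin m → Bool → Fin m → Bool → Bool
  correction a p a′ p′ = τ F a b ∧ p′ xor τ F a′ b ∧ p xor (τ F a b ∧ τ F a′ b) ∧ sum J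

  τ′ : Colour → Colour → Bool
  τ′ (a , p , q) (a′ , p′ , q′) =
    τ F a a′ xor (if q ∨ q′ then false else correction a p a′ p′)

  private
    correction-shape : ∀ X X′ p p′ s → X ∧ p′ xor X′ ∧ p xor (X ∧ X′) ∧ s
                                     ≡ X′ ∧ p xor X ∧ p′ xor (X′ ∧ X) ∧ s
    correction-shape = solve-∀ GF₂

  τ′-sym : ∀ c d → τ′ c d ≡ τ′ d c
  τ′-sym (a , p , q) (a′ , p′ , q′) =
    cong₂ _xor_ (τ-sym F a a′)
      (cong₂ (λ r c → if r then false else c) (∨-comm q q′)
             (correction-shape (τ F a b) (τ F a′ b) p p′ (sum J)))

  colour-code : Fin (m * 4) ↔ Colour
  colour-code = ↔-trans *↔× (↔-refl ×-↔ ↔-trans *↔× (2↔Bool ×-↔ 2↔Bool))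

  refine : Flip n (m * 4)
  refine = flipVia colour-code colour τ′ τ′-sym

  outsideColour : Fin m → Fin (m * 4)
  outsideColour a = Inverse.from colour-code (a , sum J ∧ τ F a b , false)

  ι-refine-outside : (∀ v → J v ≡ true → ι F v ≡ b) → ∀ {u} → J u ≡ false →
                     (∀ v → J v ≡ true → (G ⊕ F) u v ≡ false) →
                     ι refine u ≡ outsideColour (ι F u)
  ι-refine-outside J⊆b {u} Ju no-edges =
    cong₂ (λ p q → Inverse.from colour-code (ι F u , p , q)) parity Ju
    where
      edge : ∀ v → J v ∧ G u v ≡ J v ∧ τ F (ι F u) b
      edge v with J v in Jv
      ... | false = refl
      ... | true  = trans (⊕-non-adjacent {G = G} {F} (∉-≢ {S = J} {u = u} {v = v} Ju Jv) (no-edges v Jv))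
                          (cong (τ F (ι F u)) (J⊆b v Jv))
      parity : neighbourParity u ≡ sum J ∧ τ F (ι F u) b
      parity = trans (sum-cong-≗ edge) (sym (*-distribʳ-sum (τ F (ι F u) b) J))

  module _ (G-sym : ∀ x y → G x y ≡ G y x) (J⊆b : ∀ v → J v ≡ true → ι F v ≡ b)
           (J-indep : Independent G J) (J-indep⊕ : Independent (G ⊕ F) J) where

    private
      expand : ∀ j g₁ g₂ X Y → j ∧ ((g₁ xor X) ∧ (g₂ xor Y))
                             ≡ j ∧ (g₁ ∧ g₂) xor X ∧ (j ∧ g₂) xor Y ∧ (j ∧ g₁) xor (X ∧ Y) ∧ j
      expand = solve-∀ GF₂

    commonParity-⊕-outside : ∀ {x y} → J x ≡ false → J y ≡ false →
      commonParity (G ⊕ F) J x y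
      ≡ commonParity G J x y xor correction (ι F x) (neighbourParity x) (ι F y) (neighbourParity y)
    commonParity-⊕-outside {x} {y} Jx Jy = begin
      sum (λ v → J v ∧ ((G ⊕ F) x v ∧ (G ⊕ F) v y))
        ≡⟨ sum-cong-≗ (λ v → trans (unflip v) (expand (J v) (G x v) (G v y) X Y)) ⟩
      sum (λ v → J v ∧ (G x v ∧ G v y) xor X ∧ (J v ∧ G v y) xor Y ∧ (J v ∧ G x v)
                 xor (X ∧ Y) ∧ J v)
        ≡⟨ sum-combination _ (λ v → J v ∧ G v y) (λ v → J v ∧ G x v) J X Y (X ∧ Y) ⟩
      commonParity G J x y xor X ∧ sum (λ v → J v ∧ G v y) xor Y ∧ neighbourParity x
                           xor (X ∧ Y) ∧ sum J
        ≡⟨ cong (λ p → commonParity G J x y xor X ∧ p xor Y ∧ neighbourParity x xor (X ∧ Y) ∧ sum J)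
                (sum-cong-≗ λ v → cong (J v ∧_) (G-sym v y)) ⟩
      commonParity G J x y xor correction (ι F x) (neighbourParity x) (ι F y) (neighbourParity y) ∎
      where
        open ≡-Reasoning
        X Y : Bool
        X = τ F (ι F x) b
        Y = τ F (ι F y) b
        unflip : ∀ v → J v ∧ ((G ⊕ F) x v ∧ (G ⊕ F) v y) ≡ J v ∧ ((G x v xor X) ∧ (G v y xor Y))
        unflip v with J v in Jv
        ... | false = refl
        ... | true  = cong₂ _∧_
          (trans (offDiag-≢ (∉-≢ {S = J} {u = x} {v = v} Jx Jv))
                 (cong (λ c → G x v xor τ F (ι F x) c) (J⊆b v Jv)))
          (trans (offDiag-≢ (≢-sym (∉-≢ {S = J} {u = y} {v = v} Jy Jv)))
                 (cong (G v y xor_) (trans (cong (λ c → τ F c (ι F y)) (J⊆b v Jv)) (τ-sym F b (ι F y)))))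

    commonParity-⊕-inside : ∀ {x y} → J x ≡ true ⊎ J y ≡ true →
                            commonParity (G ⊕ F) J x y ≡ commonParity G J x y xor false
    commonParity-⊕-inside Jx⊎Jy =
      trans (commonParity-vanishes J-indep⊕ (λ _ Jv → Jv) Jx⊎Jy)
            (sym (trans (xor-identityʳ _) (commonParity-vanishes J-indep (λ _ Jv → Jv) Jx⊎Jy)))

    commonParity-⊕ : ∀ x y →
      commonParity (G ⊕ F) J x y
      ≡ commonParity G J x y xor (if J x ∨ J y then false
                                  else correction (ι F x) (neighbourParity x) (ι F y) (neighbourParity y))
    commonParity-⊕ x y with J x in Jx | J y in Jy
    ... | true  | _     = commonParity-⊕-inside (inj₁ Jx)
    ... | false | true  = commonParity-⊕-inside (inj₂ Jy)
    ... | false | false = commonParity-⊕-outside Jx Jy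

    LC-⊕-refine : (LC G J ⊕ refine) ≐ LC (G ⊕ F) J
    LC-⊕-refine x y =
      trans (⊕-flipVia colour-code {G = LC G J} colour τ′ τ′-sym x y) (offDiag-cong x y regroup)
      where
        open ≡-Reasoning
        T D : Bool
        T = τ F (ι F x) (ι F y)
        D = if J x ∨ J y then false else correction (ι F x) (neighbourParity x) (ι F y) (neighbourParity y)
        regroup : x ≢ y → LC G J x y xor τ′ (colour x) (colour y)
                        ≡ (G ⊕ F) x y xor commonParity (G ⊕ F) J x y
        regroup x≢y = begin
          LC G J x y xor (T xor D)
            ≡⟨ cong (_xor (T xor D)) (offDiag-≢ x≢y) ⟩
          (G x y xor commonParity G J x y) xor (T xor D)
            ≡⟨ xor-interchange (G x y) _ T D ⟩
          (G x y xor T) xor (commonParity G J x y xor D)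
            ≡⟨ cong ((G x y xor T) xor_) (commonParity-⊕ x y) ⟨
          (G x y xor T) xor commonParity (G ⊕ F) J x y
            ≡⟨ cong (_xor commonParity (G ⊕ F) J x y) (offDiag-≢ x≢y) ⟨
          (G ⊕ F) x y xor commonParity (G ⊕ F) J x y ∎

pick-independent : ∀ {n} {G : Graph n} {S} → Loopless G → ∀ d → Independent G (pick S d)
pick-independent G-loopless (yes (v , _)) u w u∈ w∈
  with refl ← ｛｝-sound {u = u} {v = v} u∈ | refl ← ｛｝-sound {u = w} {v = v} w∈ = G-loopless v

LC-pick-twins : ∀ {n} {G : Graph n} {S} t →
                (∀ u w → S u ≡ true → S w ≡ true → u ≢ w → G u w ≡ t) →
                ∀ d → Independent (LC G (pick S d)) (S ∖ pick S d)
LC-pick-twins {S = S} t twins (no S-empty) u w u∈ _ = ⊥-elim (S-empty (u , ∧-conicalˡ (S u) _ u∈))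
LC-pick-twins {G = G} {S} t twins (yes (v₀ , Sv₀)) u w u∈ w∈ with u ≟ w
... | yes refl = refl
... | no  u≢w  = begin
  G u w xor commonParity G ｛ v₀ ｝ u w  ≡⟨ cong (G u w xor_) (sum-｛｝ v₀ _) ⟩
  G u w xor (G u v₀ ∧ G v₀ w)             ≡⟨ cong₂ _xor_ (twins u w Su Sw u≢w)
                                               (cong₂ _∧_ (twins u v₀ Su Sv₀ (∉｛｝ {S = S} u∈))
                                                          (twins v₀ w Sv₀ Sw (≢-sym (∉｛｝ {S = S} w∈)))) ⟩
  t xor (t ∧ t)                           ≡⟨ cong (t xor_) (∧-idem t) ⟩
  t xor t                                 ≡⟨ xor-same t ⟩
  false                                   ∎
  where
    open ≡-Reasoning
    Su = ∧-conicalˡ (S u) _ u∈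
    Sw = ∧-conicalˡ (S w) _ w∈

module Classes {n k} (I : VSet n) (ι₀ : Fin n → Fin k) where

  classOf : Fin k → VSet n
  classOf a u = I u ∧ ｛ a ｝ (ι₀ u)

  classOf-⊆ : ∀ a → classOf a ⊆ I
  classOf-⊆ a u = ∧-conicalˡ (I u) _

  classOf-colour : ∀ {a u} → classOf a u ≡ true → ι₀ u ≡ a
  classOf-colour {u = u} h = ｛｝-sound (∧-conicalʳ (I u) _ h)

  classOf-intro : ∀ {a u} → I u ≡ true → ι₀ u ≡ a → classOf a u ≡ true
  classOf-intro {u = u} Iu refl = cong₂ _∧_ Iu (｛｝-self (ι₀ u))

  classOf-≢ : ∀ {a u} → ι₀ u ≢ a → classOf a u ≡ false
  classOf-≢ {u = u} ι₀u≢a = trans (cong (I u ∧_) (｛｝-≢ ι₀u≢a)) (∧-zeroʳ (I u))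

  pivot rest : Fin k → VSet n
  pivot a = pick (classOf a) (nonEmpty? (classOf a))
  rest  a = classOf a ∖ pivot a

  pivot-⊆ : ∀ a → pivot a ⊆ classOf a
  pivot-⊆ a = pick-⊆ (nonEmpty? (classOf a))

  rest-⊆ : ∀ a → rest a ⊆ classOf a
  rest-⊆ a = ∖-⊆

  classOf-split : ∀ {a u} → classOf a u ≡ true → pivot a u ≡ true ⊎ rest a u ≡ true
  classOf-split {a} {u} = ∖-split {S = classOf a} {T = pivot a} {u}

  parts : List (Fin k) → List (VSet n)
  parts []       = []
  parts (a ∷ as) = pivot a ∷ rest a ∷ parts as

  parts-length : ∀ as → length (parts as) ≡ 2 * length as
  parts-length []       = refl
  parts-length (a ∷ as) = trans (cong (2 +_) (parts-length as)) (sym (*-suc 2 (length as)))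

  parts-⊆ : ∀ as → All (_⊆ I) (parts as)
  parts-⊆ []       = []
  parts-⊆ (a ∷ as) =
    ⊆-trans (pivot-⊆ a) (classOf-⊆ a) ∷ ⊆-trans (rest-⊆ a) (classOf-⊆ a) ∷ parts-⊆ as

  parts-cover : ∀ {as v} → I v ≡ true → ι₀ v ∈ as → Any (λ J → J v ≡ true) (parts as)
  parts-cover {a ∷ as} Iv (here ι₀v≡a) with classOf-split (classOf-intro Iv ι₀v≡a)
  ... | inj₁ v∈pivot = here v∈pivot
  ... | inj₂ v∈rest  = there (here v∈rest)
  parts-cover {a ∷ as} Iv (there ι₀v∈as) = there (there (parts-cover Iv ι₀v∈as))

  parts-classes : ∀ as → All (λ J → ∀ v → J v ≡ true → ι₀ v ∈ as) (parts as)
  parts-classes []       = []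
  parts-classes (a ∷ as) =
      (λ v → here ∘ classOf-colour ∘ pivot-⊆ a v)
    ∷ (λ v → here ∘ classOf-colour ∘ rest-⊆ a v)
    ∷ All.map (λ J⊆as v → there ∘ J⊆as v) (parts-classes as)

  parts-disjoint : ∀ {as} → Unique as → AllPairs Disjoint (parts as)
  parts-disjoint []                         = []
  parts-disjoint {a ∷ as} (a∉as ∷ as-unique) =
    (Disjoint-∖ ∷ apart (pivot-⊆ a)) ∷ apart (rest-⊆ a) ∷ parts-disjoint as-unique
    where
      apart : ∀ {S} → S ⊆ classOf a → All (Disjoint S) (parts as)
      apart S⊆a = All.map (λ J⊆as v (Sv , Jv) →
                             All.lookup a∉as (J⊆as v Jv) (sym (classOf-colour (S⊆a v Sv))))
                          (parts-classes as)

-- Sweeping through the colour classes of I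

-- Each class costs two refinements, each multiplying the number of colours by 4.
sweepSize : ℕ → ℕ → ℕ
sweepSize zero    m = m
sweepSize (suc j) m = sweepSize j (m * 4 * 4)

module Sweep {n k} {H : Graph n} (H-loopless : Loopless H) {I : VSet n} (I-indep : Independent H I)
             (ι₀ : Fin n → Fin k) where

  open Classes I ι₀

  -- P is the part of I complemented so far; `factors` keeps every unprocessed class of I inside
  -- one colour class of the current flip, as required by LC-⊕-refine.
  record Stage (m : ℕ) (G : Graph n) (P : VSet n) : Set where
    field
      flip      : Flip n m
      colouring : Fin k → Fin m
      simple    : IsSimple G
      ⊕≐LC      : (G ⊕ flip) ≐ LC H P
      P⊆I       : P ⊆ I
      factors   : ∀ u → I u ≡ true → P u ≡ false → ι flip u ≡ colouring (ι₀ u)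

    I-indep⊕ : Independent (G ⊕ flip) I
    I-indep⊕ u w Iu Iw =
      trans (⊕≐LC u w) (trans (LC-fixes I-indep H-loopless P⊆I (inj₁ Iu)) (I-indep u w Iu Iw))

    class-colour : ∀ {a u} → classOf a u ≡ true → P u ≡ false → ι flip u ≡ colouring a
    class-colour {a} {u} u∈a Pu =
      trans (factors u (classOf-⊆ a u u∈a) Pu) (cong colouring (classOf-colour u∈a))

  step : ∀ {m G P} → Stage m G P → ∀ a {J} → J ⊆ classOf a → Disjoint P J → Independent G J →
         Stage (m * 4) (G ⋆ₛ J) (P ∪ J)
  step {G = G} {P} s a {J} J⊆a P∩J J-indep = record
    { flip      = refine
    ; colouring = outsideColour ∘ colouring
    ; simple    = IsSimple-resp-≐ (λ x y → sym (G⋆J≐LC x y)) (LC-simple J simple)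
    ; ⊕≐LC      = λ x y → begin
        ((G ⋆ₛ J) ⊕ refine) x y  ≡⟨ ⊕-cong refine G⋆J≐LC x y ⟩
        (LC G J ⊕ refine) x y    ≡⟨ LC-⊕-refine (IsSimple.sym simple) J-colour J-indep J-indep⊕ x y ⟩
        LC (G ⊕ flip) J x y      ≡⟨ LC-cong-graph J ⊕≐LC x y ⟩
        LC (LC H P) J x y        ≡⟨ LC-merge I-indep H-loopless P⊆I J⊆I P∩J x y ⟩
        LC H (P ∪ J) x y         ∎
    ; P⊆I       = ∪-⊆ P⊆I J⊆I
    ; factors   = λ u Iu u∉P∪J →
        trans (ι-refine-outside J-colour (∨-conicalʳ (P u) _ u∉P∪J)
                                (λ v Jv → I-indep⊕ u v Iu (J⊆I v Jv)))
              (cong outsideColour (factors u Iu (∨-conicalˡ (P u) _ u∉P∪J))) }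
    where
      open Stage s
      open Refinement G flip J (colouring a)
      open ≡-Reasoning
      J⊆I : J ⊆ I
      J⊆I v = classOf-⊆ a v ∘ J⊆a v
      J-colour : ∀ v → J v ≡ true → ι flip v ≡ colouring a
      J-colour v Jv = class-colour (J⊆a v Jv) (Disjoint⇒false P∩J Jv)
      J-indep⊕ : Independent (G ⊕ flip) J
      J-indep⊕ u w Ju Jw = I-indep⊕ u w (J⊆I u Ju) (J⊆I w Jw)
      G⋆J≐LC : (G ⋆ₛ J) ≐ LC G J
      G⋆J≐LC = ⋆ₛ≐LC (IsSimple.irrefl simple) J-indep

  record Swept (m : ℕ) (as : List (Fin k)) (G : Graph n) (P : VSet n) : Set where
    field
      valid  : ValidSeq G (parts as)
      done   : VSet n
      final  : Stage (sweepSize (length as) m) (⋆Seq G (parts as)) done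
      P⊆done : P ⊆ done
      covers : ∀ u → I u ≡ true → ι₀ u ∈ as → done u ≡ true

  sweep : ∀ as → Unique as → ∀ {m G P} → Stage m G P → (∀ u → ι₀ u ∈ as → P u ≡ false) →
          Swept m as G P
  sweep [] _ {P = P} s _ = record
    { valid = tt ; done = P ; final = s ; P⊆done = λ _ Pu → Pu ; covers = λ _ _ () }
  sweep (a ∷ as) (a∉as ∷ as-unique) {m} {G} {P} s untouched = record
    { valid  = pivot-indep , rest-indep , R.valid
    ; done   = R.done
    ; final  = R.final
    ; P⊆done = ⊆-trans P⊆P₂ R.P⊆done
    ; covers = covers }
    where
      open Stage s
      P∩a : Disjoint P (classOf a)
      P∩a = Disjoint-intro λ u u∈a → untouched u (here (classOf-colour u∈a))

      pivot-indep : Independent G (pivot a)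
      pivot-indep = pick-independent (IsSimple.irrefl simple) (nonEmpty? (classOf a))

      -- The class is a clique or an independent set of G; after complementing at its pivot the
      -- rest is independent, whichever it is.
      twins : ∀ u w → classOf a u ≡ true → classOf a w ≡ true → u ≢ w →
              G u w ≡ τ flip (colouring a) (colouring a)
      twins u w u∈a w∈a u≢w =
        trans (⊕-non-adjacent {G = G} {flip} u≢w
                 (I-indep⊕ u w (classOf-⊆ a u u∈a) (classOf-⊆ a w w∈a)))
              (cong₂ (τ flip) (class-colour u∈a (Disjoint⇒false P∩a u∈a))
                              (class-colour w∈a (Disjoint⇒false P∩a w∈a)))

      rest-indep : Independent (G ⋆ₛ pivot a) (rest a)
      rest-indep =
        Independent-resp-≐ (λ x y → sym (⋆ₛ≐LC (IsSimple.irrefl simple) pivot-indep x y))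
                           (LC-pick-twins (τ flip (colouring a) (colouring a)) twins (nonEmpty? (classOf a)))

      P₂ : VSet n
      P₂ = (P ∪ pivot a) ∪ rest a

      s₂ : Stage (m * 4 * 4) ((G ⋆ₛ pivot a) ⋆ₛ rest a) P₂
      s₂ = step (step s a (pivot-⊆ a) (Disjoint-⊆ P∩a (pivot-⊆ a)) pivot-indep)
                a (rest-⊆ a) (Disjoint-∪ (Disjoint-⊆ P∩a (rest-⊆ a)) Disjoint-∖) rest-indep

      P⊆P₂ : P ⊆ P₂
      P⊆P₂ = ⊆-trans ⊆-∪ˡ ⊆-∪ˡ

      class⊆P₂ : classOf a ⊆ P₂
      class⊆P₂ u u∈a with classOf-split u∈a
      ... | inj₁ u∈pivot = ⊆-∪ˡ {S = P ∪ pivot a} {rest a} u (⊆-∪ʳ {S = P} {pivot a} u u∈pivot)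
      ... | inj₂ u∈rest  = ⊆-∪ʳ {S = P ∪ pivot a} {rest a} u u∈rest

      untouched₂ : ∀ u → ι₀ u ∈ as → P₂ u ≡ false
      untouched₂ u ι₀u∈as =
        cong₂ _∨_ (cong₂ _∨_ (untouched u (there ι₀u∈as)) (⊆-false (pivot-⊆ a) u∉a))
                  (⊆-false (rest-⊆ a) u∉a)
        where u∉a = classOf-≢ λ ι₀u≡a → All.lookup a∉as ι₀u∈as (sym ι₀u≡a)

      module R = Swept (sweep as as-unique s₂ untouched₂)

      covers : ∀ u → I u ≡ true → ι₀ u ∈ a ∷ as → R.done u ≡ true
      covers u Iu (here ι₀u≡a)   = R.P⊆done u (class⊆P₂ u (classOf-intro Iu ι₀u≡a))
      covers u Iu (there ι₀u∈as) = R.covers u Iu ι₀u∈as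

module Construction {n k} (G : Graph n) (G-simple : IsSimple G) (F : Flip n k) (I : VSet n)
                    (I-indep : Independent (G ⊕ F) I) where

  ⊕-loopless : Loopless (G ⊕ F)
  ⊕-loopless x = offDiag-diag x

  open Classes I (ι F)
  open Sweep ⊕-loopless I-indep (ι F)

  initial : Stage k G ∅
  initial = record
    { flip      = F
    ; colouring = λ a → a
    ; simple    = G-simple
    ; ⊕≐LC      = λ x y → sym (LC-∅ ⊕-loopless x y)
    ; P⊆I       = λ _ ()
    ; factors   = λ _ _ _ → refl }

  open Swept (sweep (allFin k) (allFin⁺ k) initial (λ _ _ → refl))

  allParts Js : List (VSet n)
  allParts = parts (allFin k)
  Js = filter nonEmpty? allParts

  allFin-length : length (allFin k) ≡ k
  allFin-length = length-tabulate (λ a → a)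

  Js-length : length Js ≤ 2 * k
  Js-length = ≤-trans (length-filter nonEmpty? allParts)
                      (≤-reflexive (trans (parts-length (allFin k)) (cong (2 *_) allFin-length)))

  Js-partition : IsPartition Js I
  Js-partition = IsPartition-filter (parts-⊆ (allFin k)) (λ v Iv → parts-cover Iv (∈-allFin (ι F v)))
                                    (parts-disjoint (allFin⁺ k))

  Js-valid : ValidSeq G Js
  Js-valid = ValidSeq-filter allParts valid

  Js-⊕-flip : (⋆Seq G Js ⊕ Stage.flip final) ≐ ((G ⊕ F) ⋆ₛ I)
  Js-⊕-flip x y = begin
    (⋆Seq G Js ⊕ flip) x y        ≡⟨ cong (λ K → (K ⊕ flip) x y) (⋆Seq-filter G allParts) ⟩
    (⋆Seq G allParts ⊕ flip) x y  ≡⟨ ⊕≐LC x y ⟩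
    LC (G ⊕ F) done x y           ≡⟨ LC-cong-set {K = G ⊕ F} done≗I x y ⟩
    LC (G ⊕ F) I x y              ≡⟨ ⋆ₛ≐LC ⊕-loopless I-indep x y ⟨
    ((G ⊕ F) ⋆ₛ I) x y            ∎
    where
      open ≡-Reasoning
      open Stage final
      done≗I : ∀ v → done v ≡ I v
      done≗I = ⊆-antisym P⊆I (λ v Iv → covers v Iv (∈-allFin (ι F v)))

  -- The sweep counts colours by length (allFin k), which equals k only propositionally.
  Js-flip : Σ (Flip n (sweepSize k k)) λ F′ → (⋆Seq G Js ⊕ F′) ≐ ((G ⊕ F) ⋆ₛ I)
  Js-flip = subst (λ j → Σ (Flip n (sweepSize j k)) λ F′ → (⋆Seq G Js ⊕ F′) ≐ ((G ⊕ F) ⋆ₛ I))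
                  allFin-length
                  (Stage.flip final , Js-⊕-flip)

corollary6 : Σ (ℕ → ℕ) λ f →
    ∀ {n k : ℕ} (G : Graph n) → IsSimple G → (F : Flip n k) → (I : VSet n) →
    Independent (G ⊕ F) I →
    Σ (List (VSet n)) λ Js →
      length Js ≤ 2 * k × IsPartition Js I × ValidSeq G Js ×
      Σ (Flip n (f k)) λ F′ → (⋆Seq G Js ⊕ F′) ≐ ((G ⊕ F) ⋆ₛ I)
corollary6 = (λ k → sweepSize k k) , λ G G-simple F I I-indep →
  let open Construction G G-simple F I I-indep
  in Js , Js-length , Js-partition , Js-valid , Js-flip
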